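{- Let $\boldsymbol\Gamma\in\Gamma\mathsf{Dom}$ (with $k$ components). Then the system of set-equations $\mathbf Y=\boldsymbol\Gamma(\mathbf Y)$ has a minimum solution $\mathbf S$ (i.e. $\mathbf S=\boldsymbol\Gamma(\mathbf S)$ and $\mathbf S\le\mathbf T$ for every $\mathbf T\in\mathrm{Su}(\mathbb N)^k$ with $\mathbf T=\boldsymbol\Gamma(\mathbf T)$), and it is given by $\mathbf S=\boldsymbol\Gamma^{(\infty)}(\boldsymbol\emptyset)=\bigcup_{n\ge0}\boldsymbol\Gamma^{(n)}(\boldsymbol\emptyset)$. If $\boldsymbol\Gamma\in\Gamma\mathsf{Dom}_0$, then for $1\le i\le k$ one has $S_i=\emptyset$ if and only if $\Gamma^{(k)}_{\ i}(\boldsymbol\emptyset)=\emptyset$.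
   Context: $\mathbb N=\{0,1,\dots\}$, $\mathbb P=\{1,2,\dots\}$, $\mathrm{Su}(X)$ the set of subsets of $X$. For $A,B\subseteq\mathbb N$, $A+B=\{a+b\}$; $n\star B=\{0\}$ if $n=0$ and $B+\cdots+B$ ($n$ copies) if $n\ge1$. For $\mathbf u\in\mathbb N^k$, $\mathbf u\star\mathbf Y=u_1\star Y_1+\cdots+u_k\star Y_k$. $\Gamma\mathsf{Dom}$ is the set of maps $\boldsymbol\Gamma:\mathrm{Su}(\mathbb N)^k\to\mathrm{Su}(\mathbb N)^k$ of the form $\Gamma_i(\mathbf Y)=\bigcup_{\mathbf u\in\mathbb N^k}(\Gamma_{i,\mathbf u}+\mathbf u\star\mathbf Y)$ with fixed $\Gamma_{i,\mathbf u}\subseteq\mathbb N$; $\Gamma\mathsf{Dom}_0$ consists of those mapping $\mathrm{Su}(\mathbb P)^k$ into itself. $\boldsymbol\Gamma^{(n)}$ is the $n$-fold composition, $\Gamma^{(n)}_{\ i}$ its $i$th component. $\boldsymbol\emptyset=(\emptyset,\dots,\emptyset)$; $\mathbf A\le\mathbf B$ means $A_i\subseteq B_i$ for all $i$; unions of tuples are componentwise. -}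

module Defs where

open import Level using (0ℓ)
open import Data.Nat using (ℕ; zero; suc; _+_)
open import Data.Fin using (Fin; zero; suc)
open import Data.Product using (Σ; ∃; _×_; _,_)
open import Relation.Binary.PropositionalEquality using (_≡_)
open import Relation.Nullary using (¬_)
open import Function using (_∘_)
open import Data.Empty using (⊥)

Su : Set₁
Su = ℕ → Set

_⊕_ : Su → Su → Su
(A ⊕ B) m = Σ ℕ λ a → Σ ℕ λ b → A a × B b × (m ≡ a + b)

-- n ⋆ B : {0} if n = 0, B + ... + B (n copies) if n ≥ 1
-- (defined as (n-1)⋆B + B, which agrees since {0} + B = B).
_⋆_ : ℕ → Su → Su
(zero ⋆ B) m = m ≡ 0
(suc n ⋆ B) = (n ⋆ B) ⊕ B

_⋆ᵛ_ : ∀ {k} → (Fin k → ℕ) → (Fin k → Su) → Su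
_⋆ᵛ_ {zero} u Y m = m ≡ 0
_⋆ᵛ_ {suc k} u Y = (u zero ⋆ Y zero) ⊕ ((u ∘ suc) ⋆ᵛ (Y ∘ suc))

-- An element of ΓDom with k components is given by its coefficient sets Γ_{i,u}.
ΓDom : ℕ → Set₁
ΓDom k = Fin k → (Fin k → ℕ) → Su

apply : ∀ {k} → ΓDom k → (Fin k → Su) → (Fin k → Su)
apply Γ Y i m = Σ (_ → ℕ) λ u → ((Γ i u) ⊕ (u ⋆ᵛ Y)) m

iter : ∀ {k} → ΓDom k → ℕ → (Fin k → Su) → (Fin k → Su)
iter Γ zero Y = Y
iter Γ (suc n) Y = apply Γ (iter Γ n Y)

∅ᵛ : ∀ {k} → Fin k → Su
∅ᵛ i m = ⊥

iterUnion : ∀ {k} → ΓDom k → Fin k → Su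
iterUnion Γ i m = ∃ λ n → iter Γ n ∅ᵛ i m

_≤ᵛ_ : ∀ {k} → (Fin k → Su) → (Fin k → Su) → Set
A ≤ᵛ B = ∀ i m → A i m → B i m

_≈ᵛ_ : ∀ {k} → (Fin k → Su) → (Fin k → Su) → Set
A ≈ᵛ B = (A ≤ᵛ B) × (B ≤ᵛ A)

IsEmpty : Su → Set
IsEmpty A = ∀ m → ¬ A m

InSuP : Su → Set
InSuP A = ¬ A 0

IsΓDom₀ : ∀ {k} → ΓDom k → Set₁
IsΓDom₀ {k} Γ = (Y : Fin k → Su) → (∀ i → InSuP (Y i)) → ∀ i → InSuP (apply Γ Y i)

-- Γ is monotone and commutes with unions of increasing chains, because an element of u ⋆ Y
-- involves only finitely many elements of Y; hence the union of the iterates Γ⁽ⁿ⁾(∅) is its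
-- least fixed point (Kleene). Whether Γ⁽ⁿ⁾(∅)ᵢ is nonempty depends only on which components
-- of Γ⁽ⁿ⁻¹⁾(∅) are nonempty, through Horn clauses "i holds if Γ_{i,u} ≠ ∅ and every j with
-- u_j > 0 holds". A derivation in such a system that uses an atom twice along a branch can be
-- cut at the lower occurrence, so all derivations can be taken of depth at most k.
module Submission where

open import Defs
open import Data.Nat using (ℕ; zero; suc; _+_; _≤_; z≤n; s≤s; _⊔_)
open import Data.Nat.Properties using (m≤m⊔n; m≤n⊔m; ≤-reflexive; <-≤-trans; ≤-pred; n≮0)
open import Data.Fin using (Fin; zero; suc; _≟_)
open import Data.Fin.Subset using (Subset; _∈_; ⊤; _-_; ∣_∣) renaming (_⊆_ to _⊆ₛ_)
open import Data.Fin.Subset.Properties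
  using (∈⊤; ∣⊤∣≡n; p─q⊆p; x∈p∧x≢y⇒x∈p-y; x∈p⇒∣p-x∣<∣p∣)
open import Data.Product using (Σ; ∃; _×_; _,_; proj₁; proj₂)
open import Data.Sum using (_⊎_; inj₁; inj₂; map₂; assocˡ)
open import Data.Empty using (⊥; ⊥-elim)
open import Function using (_∘_)
open import Function.Bundles using (_⇔_; mk⇔; Equivalence)
open import Relation.Binary.PropositionalEquality using (_≡_; refl)
open import Relation.Nullary using (yes; no)
open import Relation.Unary using (_⊆_; Satisfiable; Empty)

∀-or-constant : ∀ {k} {P : Fin k → Set} {R : Set} → (∀ j → P j ⊎ R) → (∀ j → P j) ⊎ R
∀-or-constant {zero}  h = inj₁ λ ()
∀-or-constant {suc k} h with h zero | ∀-or-constant (h ∘ suc)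
... | inj₂ r | _       = inj₂ r
... | inj₁ _ | inj₂ r  = inj₂ r
... | inj₁ p | inj₁ ps = inj₁ λ { zero → p ; (suc j) → ps j }

module HornRounds {k : ℕ} (Rule : Fin k → Set) (Exempt : ∀ {i} → Rule i → Fin k → Set) where

  -- Derivable p n i: i has a derivation tree of depth at most n all of whose nodes lie in p;
  -- Exempt r j says that j is not a premise of the rule r.
  Derivable : Subset k → ℕ → Fin k → Set
  Derivable p zero    i = ⊥
  Derivable p (suc n) i = i ∈ p × Σ (Rule i) λ r → ∀ j → Exempt r j ⊎ Derivable p n j

  Derivable-mono-⊆ : ∀ {p q} → p ⊆ₛ q → ∀ n {i} → Derivable p n i → Derivable q n i
  Derivable-mono-⊆ p⊆q (suc n) (i∈p , r , prem) =
    p⊆q i∈p , r , λ j → map₂ (Derivable-mono-⊆ p⊆q n) (prem j)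

  Derivable-suc : ∀ {p} n {i} → Derivable p n i → Derivable p (suc n) i
  Derivable-suc (suc n) (i∈p , r , prem) = i∈p , r , λ j → map₂ (Derivable-suc n) (prem j)

  avoid-or-derive : ∀ {p} i n {j} → Derivable p n j → Derivable (p - i) n j ⊎ Derivable p n i
  avoid-or-derive i (suc n) {j} d@(j∈p , r , prem) with j ≟ i
  ... | yes refl = inj₂ d
  ... | no j≢i with ∀-or-constant (λ l → assocˡ (map₂ (avoid-or-derive i n) (prem l)))
  ...   | inj₁ prem′ = inj₁ (x∈p∧x≢y⇒x∈p-y j∈p j≢i , r , prem′)
  ...   | inj₂ dᵢ    = inj₂ (Derivable-suc n dᵢ)

  Derivable-shorten : ∀ c {p} → ∣ p ∣ ≤ c → ∀ n {i} → Derivable p n i → Derivable p c i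
  Derivable-shorten zero    ∣p∣≤0 (suc n) (i∈p , _) = ⊥-elim (n≮0 (<-≤-trans (x∈p⇒∣p-x∣<∣p∣ i∈p) ∣p∣≤0))
  Derivable-shorten (suc c) {p} ∣p∣≤c+1 (suc n) {i} (i∈p , r , prem)
    with ∀-or-constant (λ j → assocˡ (map₂ shorten-premise (prem j)))
    where
    shorten-premise : ∀ {j} → Derivable p n j → Derivable p c j ⊎ Derivable p (suc c) i
    shorten-premise dⱼ with avoid-or-derive i n dⱼ
    ... | inj₁ avoids-i = inj₁ (Derivable-mono-⊆ (p─q⊆p _ _) c
            (Derivable-shorten c (≤-pred (<-≤-trans (x∈p⇒∣p-x∣<∣p∣ i∈p) ∣p∣≤c+1)) n avoids-i))
    ... | inj₂ dᵢ = inj₂ (Derivable-shorten (suc c) ∣p∣≤c+1 n dᵢ)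
  ... | inj₁ prem′ = i∈p , r , prem′
  ... | inj₂ dᵢ    = dᵢ

  Derivable-within-k : ∀ n {i} → Derivable ⊤ n i → Derivable ⊤ k i
  Derivable-within-k = Derivable-shorten k (≤-reflexive (∣⊤∣≡n k))

⋆-mono : ∀ n {B C : Su} → B ⊆ C → (n ⋆ B) ⊆ (n ⋆ C)
⋆-mono zero    B⊆C h = h
⋆-mono (suc n) B⊆C (a , b , ha , hb , e) = a , b , ⋆-mono n B⊆C ha , B⊆C hb , e

⋆ᵛ-mono : ∀ {k} (u : Fin k → ℕ) {Y Z : Fin k → Su} → Y ≤ᵛ Z → (u ⋆ᵛ Y) ⊆ (u ⋆ᵛ Z)
⋆ᵛ-mono {zero}  u Y≤Z h = h
⋆ᵛ-mono {suc k} u Y≤Z (a , b , ha , hb , e) =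
  a , b , ⋆-mono (u zero) (Y≤Z zero _) ha , ⋆ᵛ-mono (u ∘ suc) (Y≤Z ∘ suc) hb , e

apply-mono : ∀ {k} (Γ : ΓDom k) {Y Z : Fin k → Su} → Y ≤ᵛ Z → apply Γ Y ≤ᵛ apply Γ Z
apply-mono Γ Y≤Z i m (u , a , b , ga , hb , e) = u , a , b , ga , ⋆ᵛ-mono u Y≤Z hb , e

⋃ : (ℕ → Su) → Su
⋃ F m = ∃ λ N → F N m

⋃ᵛ : ∀ {k} → (ℕ → Fin k → Su) → Fin k → Su
⋃ᵛ F i = ⋃ λ N → F N i

Increasing : ∀ {k} → (ℕ → Fin k → Su) → Set
Increasing F = ∀ {m n} → m ≤ n → F m ≤ᵛ F n

⋆-⋃ : ∀ n {k} {F : ℕ → Fin k → Su} → Increasing F → ∀ i → (n ⋆ ⋃ᵛ F i) ⊆ ⋃ (λ N → n ⋆ F N i)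
⋆-⋃ zero    inc i h = 0 , h
⋆-⋃ (suc n) inc i (a , b , ha , (N , hb) , e) with ⋆-⋃ n inc i ha
... | N′ , ha′ = N ⊔ N′ , a , b , ⋆-mono n (inc (m≤n⊔m N N′) i _) ha′ , inc (m≤m⊔n N N′) i _ hb , e

⋆ᵛ-⋃ : ∀ {k} (u : Fin k → ℕ) {F : ℕ → Fin k → Su} → Increasing F → (u ⋆ᵛ ⋃ᵛ F) ⊆ ⋃ (λ N → u ⋆ᵛ F N)
⋆ᵛ-⋃ {zero}  u inc h = 0 , h
⋆ᵛ-⋃ {suc k} u inc (a , b , ha , hb , e)
  with ⋆-⋃ (u zero) inc zero ha | ⋆ᵛ-⋃ (u ∘ suc) (λ le → inc le ∘ suc) hb
... | N , ha′ | N′ , hb′ =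
  N ⊔ N′ , a , b , ⋆-mono (u zero) (inc (m≤m⊔n N N′) zero _) ha′
         , ⋆ᵛ-mono (u ∘ suc) (inc (m≤n⊔m N N′) ∘ suc) hb′ , e

apply-⋃ : ∀ {k} (Γ : ΓDom k) {F : ℕ → Fin k → Su} → Increasing F →
          apply Γ (⋃ᵛ F) ≤ᵛ ⋃ᵛ (λ N → apply Γ (F N))
apply-⋃ Γ inc i m (u , a , b , ga , hb , e) with ⋆ᵛ-⋃ u inc hb
... | N , hb′ = N , u , a , b , ga , hb′ , e

module _ {k : ℕ} (Γ : ΓDom k) where

  iter-increasing : Increasing (λ n → iter Γ n ∅ᵛ)
  iter-increasing z≤n       i m ()
  iter-increasing (s≤s m≤n) = apply-mono Γ (iter-increasing m≤n)

  iterUnion-fixed : iterUnion Γ ≈ᵛ apply Γ (iterUnion Γ)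
  iterUnion-fixed = postfixed , prefixed
    where
    postfixed : iterUnion Γ ≤ᵛ apply Γ (iterUnion Γ)
    postfixed i m (suc n , h) = apply-mono Γ (λ i m h → n , h) i m h

    prefixed : apply Γ (iterUnion Γ) ≤ᵛ iterUnion Γ
    prefixed i m h with apply-⋃ Γ iter-increasing i m h
    ... | N , h′ = suc N , h′

  iterUnion-least : (T : Fin k → Su) → apply Γ T ≤ᵛ T → iterUnion Γ ≤ᵛ T
  iterUnion-least T ΓT≤T i m (n , h) = iter-≤ n i m h
    where
    iter-≤ : ∀ n → iter Γ n ∅ᵛ ≤ᵛ T
    iter-≤ (suc n) i m h = ΓT≤T i m (apply-mono Γ (iter-≤ n) i m h)

⋆-satisfiable : ∀ n {B : Su} → Satisfiable B → Satisfiable (n ⋆ B)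
⋆-satisfiable zero    _        = 0 , refl
⋆-satisfiable (suc n) (b , hb) with ⋆-satisfiable n (b , hb)
... | a , ha = a + b , a , b , ha , hb , refl

⋆-satisfiable⇔ : ∀ n {B : Su} → Satisfiable (n ⋆ B) ⇔ (n ≡ 0 ⊎ Satisfiable B)
⋆-satisfiable⇔ n = mk⇔ (to n) from
  where
  to : ∀ n {B} → Satisfiable (n ⋆ B) → n ≡ 0 ⊎ Satisfiable B
  to zero    _                        = inj₁ refl
  to (suc n) (_ , _ , b , _ , hb , _) = inj₂ (b , hb)

  from : ∀ {B} → n ≡ 0 ⊎ Satisfiable B → Satisfiable (n ⋆ B)
  from (inj₁ refl) = 0 , refl
  from (inj₂ s)    = ⋆-satisfiable n s

⋆ᵛ-satisfiable⇔ : ∀ {k} (u : Fin k → ℕ) {Y : Fin k → Su} →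
                  Satisfiable (u ⋆ᵛ Y) ⇔ (∀ j → u j ≡ 0 ⊎ Satisfiable (Y j))
⋆ᵛ-satisfiable⇔ u = mk⇔ (to u) (from u)
  where
  to : ∀ {k} (u : Fin k → ℕ) {Y} → Satisfiable (u ⋆ᵛ Y) → ∀ j → u j ≡ 0 ⊎ Satisfiable (Y j)
  to {suc k} u (_ , a , _ , ha , _ , _) zero    = Equivalence.to (⋆-satisfiable⇔ (u zero)) (a , ha)
  to {suc k} u (_ , _ , b , _ , hb , _) (suc j) = to (u ∘ suc) (b , hb) j

  from : ∀ {k} (u : Fin k → ℕ) {Y} → (∀ j → u j ≡ 0 ⊎ Satisfiable (Y j)) → Satisfiable (u ⋆ᵛ Y)
  from {zero}  u h = 0 , refl
  from {suc k} u h with Equivalence.from (⋆-satisfiable⇔ (u zero)) (h zero) | from (u ∘ suc) (h ∘ suc)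
  ... | a , ha | b , hb = a + b , a , b , ha , hb , refl

apply-satisfiable⇔ : ∀ {k} (Γ : ΓDom k) {Y : Fin k → Su} i →
  Satisfiable (apply Γ Y i) ⇔
  (Σ (Fin k → ℕ) λ u → Satisfiable (Γ i u) × ∀ j → u j ≡ 0 ⊎ Satisfiable (Y j))
apply-satisfiable⇔ {k} Γ {Y} i = mk⇔ to from
  where
  Premises : Set
  Premises = Σ (Fin k → ℕ) λ u → Satisfiable (Γ i u) × ∀ j → u j ≡ 0 ⊎ Satisfiable (Y j)

  to : Satisfiable (apply Γ Y i) → Premises
  to (_ , u , a , b , ga , hb , _) = u , (a , ga) , Equivalence.to (⋆ᵛ-satisfiable⇔ u) (b , hb)

  from : Premises → Satisfiable (apply Γ Y i)
  from (u , (a , ga) , prem) with Equivalence.from (⋆ᵛ-satisfiable⇔ u) prem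
  ... | b , hb = a + b , u , a , b , ga , hb , refl

module _ {k : ℕ} (Γ : ΓDom k) where

  open HornRounds (λ i → Σ (Fin k → ℕ) λ u → Satisfiable (Γ i u)) (λ r j → proj₁ r j ≡ 0)

  iter-satisfiable⇔ : ∀ n i → Satisfiable (iter Γ n ∅ᵛ i) ⇔ Derivable ⊤ n i
  iter-satisfiable⇔ zero    i = mk⇔ (λ ()) (λ ())
  iter-satisfiable⇔ (suc n) i = mk⇔ to from
    where
    to : Satisfiable (iter Γ (suc n) ∅ᵛ i) → Derivable ⊤ (suc n) i
    to s with Equivalence.to (apply-satisfiable⇔ Γ i) s
    ... | u , γ , prem = ∈⊤ , (u , γ) , λ j → map₂ (Equivalence.to (iter-satisfiable⇔ n j)) (prem j)

    from : Derivable ⊤ (suc n) i → Satisfiable (iter Γ (suc n) ∅ᵛ i)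
    from (_ , (u , γ) , prem) = Equivalence.from (apply-satisfiable⇔ Γ i)
      (u , γ , λ j → map₂ (Equivalence.from (iter-satisfiable⇔ n j)) (prem j))

  -- No use of Γ ∈ ΓDom₀ is needed here: the criterion holds for every Γ.
  iterUnion-empty⇔ : ∀ i → Empty (iterUnion Γ i) ⇔ Empty (iter Γ k ∅ᵛ i)
  iterUnion-empty⇔ i = mk⇔ (λ empty m h → empty m (k , h)) from
    where
    from : Empty (iter Γ k ∅ᵛ i) → Empty (iterUnion Γ i)
    from empty m (n , h) with Equivalence.from (iter-satisfiable⇔ k i)
                                (Derivable-within-k n (Equivalence.to (iter-satisfiable⇔ n i) (m , h)))
    ... | m′ , h′ = empty m′ h′

proposition3p5 : (k : ℕ) (Γ : ΓDom k) →
    (iterUnion Γ ≈ᵛ apply Γ (iterUnion Γ))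
    × ((T : Fin k → Su) → T ≈ᵛ apply Γ T → iterUnion Γ ≤ᵛ T)
    × (IsΓDom₀ Γ → (i : Fin k) → IsEmpty (iterUnion Γ i) ⇔ IsEmpty (iter Γ k ∅ᵛ i))
proposition3p5 k Γ =
  iterUnion-fixed Γ ,
  (λ T T≈ΓT → iterUnion-least Γ T (proj₂ T≈ΓT)) ,
  (λ _ → iterUnion-empty⇔ Γ)
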